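{- Let $G$ be a graph, $B,k,L,s\in\mathbb N$, and let $\ell\colon V(G)\to[L]\cup\{\infty\}$ be the output of $\mathrm{PartialLayerAssignment}(G,B,k,L,s)$. Then for every $v\in V(G)$ with $\ell(v)\ne\infty$, $|\{u\in N_G(v):\ell(u)\ge\ell(v)\}|\le(s+1)k$.
   Context: $[L]=\{1,\dots,L\}$, $\infty$ exceeds every integer. For a rooted tree $T$ with $\mathrm{map}\colon V(T)\to V(G)$: $\mathrm{Missing}(x)=N_G(\mathrm{map}(x))\setminus\{\mathrm{map}(c):c\text{ child of }x\}$. $\mathrm{LocalPrune}(T,k)$, root $r$: if $r$ has at most $k$ children, return $\{r\}$; otherwise for each child $c$ compute $\mathrm{LocalPrune}(T_c,k)$ ($T_c$ the subtree rooted at $c$), discard the $k$ largest of these (by node count, ties arbitrary), and return $r$ with the remaining pruned subtrees as child subtrees; mappings are restricted. $\mathrm{ExponentiateAndLocalPrune}(G,B,k,s)$: Initialization: for each $v$ with $|N_G(v)|<B$, $T^{(0)}_v$ is a root mapped to $v$ with one child mapped to each neighbor of $v$, $v$ active; for $|N_G(v)|\ge B$, $T^{(0)}_v$ is a single node mapped to $v$, $v$ inactive. For $i=1,\dots,s$: (Prune step) for every $v$, $T^{(i-1)}_{v,\mathrm{pruned}}=\mathrm{LocalPrune}(T^{(i-1)}_v,k)$; if it has more than $\sqrt B$ nodes, mark $v$ inactive (permanently). (Attachment step, after pruning all $v$) for every $v$: if inactive, $T^{(i)}_v=T^{(i-1)}_{v,\mathrm{pruned}}$; otherwise replace each leaf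 $x_j$ of $T^{(i-1)}_{v,\mathrm{pruned}}$ at distance exactly $2^{i-1}$ from the root that maps to an active vertex $u_j$ by a fresh copy of $T^{(i-1)}_{u_j,\mathrm{pruned}}$ (its root taking the place of $x_j$), mapping inherited. $\mathrm{PartialLayerAssignmentTree}(G,T,\mathrm{map},a,L)$: $V_{\ge1}=V(T)$; for $j=1,\dots,L$: $V_j=\{x\in V_{\ge j}:|\mathrm{children}_T(x)\cap V_{\ge j}|+|\mathrm{Missing}(x)|\le a\}$, $\ell_T=j$ on $V_j$, $V_{\ge j+1}=V_{\ge j}\setminus V_j$; $\ell_T=\infty$ on $V_{\ge L+1}$. $\mathrm{PartialLayerAssignment}(G,B,k,L,s)$: compute $(T^{(s)}_v,\mathrm{map}^{(s)}_v)_v=\mathrm{ExponentiateAndLocalPrune}(G,B,k,s)$; for each $v$, $\ell_v=\mathrm{PartialLayerAssignmentTree}(G,T^{(s)}_v,\mathrm{map}^{(s)}_v,(s+1)k,L)$; output $\ell(u)=\min\{\ell_v(x):v\in V(G),x\in V(T^{(s)}_v),\mathrm{map}^{(s)}_v(x)=u\}$. -}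

module Defs where

open import Data.Bool using (Bool; true; false; _∧_; not; if_then_else_)
open import Data.Nat using (ℕ; zero; suc; _+_; _*_; _^_; _≤_; _<_; _≤ᵇ_; _<ᵇ_)
open import Data.Fin using (Fin) renaming (zero to fzero; suc to fsuc)
import Data.Fin as Fin
open import Data.Bool.ListAction using (any)
open import Data.List using (List; []; _∷_; length; map; filterᵇ; _++_; concatMap; lookup; foldr; allFin)
open import Data.List.Membership.Propositional using (_∈_)
open import Data.List.Relation.Binary.Pointwise using (Pointwise)
open import Data.Product using (Σ; _×_; _,_; proj₁; proj₂)
open import Relation.Binary.PropositionalEquality using (_≡_)
open import Relation.Nullary.Decidable using (⌊_⌋)

record Graph : Set where
  field
    n      : ℕ
    Adj    : Fin n → Fin n → Bool
    sym    : ∀ u v → Adj u v ≡ Adj v u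
    irrefl : ∀ v → Adj v v ≡ false

open Graph public

nbrs : (G : Graph) → Fin (n G) → List (Fin (n G))
nbrs G v = filterᵇ (Adj G v) (allFin (n G))

deg : (G : Graph) → Fin (n G) → ℕ
deg G v = length (nbrs G v)

data ℕ∞ : Set where
  fin : ℕ → ℕ∞
  ∞   : ℕ∞

_≤∞ᵇ_ : ℕ∞ → ℕ∞ → Bool
fin m ≤∞ᵇ fin n = m ≤ᵇ n
fin m ≤∞ᵇ ∞     = true
∞     ≤∞ᵇ fin n = false
∞     ≤∞ᵇ ∞     = true

_⊓∞_ : ℕ∞ → ℕ∞ → ℕ∞
x ⊓∞ y = if x ≤∞ᵇ y then x else y

-- Rooted trees whose nodes are labelled by (mapped to) elements of A.
-- The label of a node is map(x).

data Tree (A : Set) : Set where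
  node : A → List (Tree A) → Tree A

module _ {A : Set} where

  root : Tree A → A
  root (node a _) = a

  kids : Tree A → List (Tree A)
  kids (node _ cs) = cs

  mutual
    size : Tree A → ℕ
    size (node _ cs) = suc (sizes cs)

    sizes : List (Tree A) → ℕ
    sizes []       = 0
    sizes (c ∷ cs) = size c + sizes cs

  data Pos : Tree A → Set where
    here  : ∀ {t} → Pos t
    there : ∀ {a cs} (i : Fin (length cs)) → Pos (lookup cs i) → Pos (node a cs)

  sub : {t : Tree A} → Pos t → Tree A
  sub {t} here        = t
  sub (there i p) = sub p

  label : {t : Tree A} → Pos t → A
  label p = root (sub p)

  child : {t : Tree A} (x : Pos t) → Fin (length (kids (sub x))) → Pos t
  child {node _ _} here i = there i here
  child (there j p) i = there j (child p i)

  mutual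
    allPos : (t : Tree A) → List (Pos t)
    allPos (node a cs) = here ∷ map (λ ip → there (proj₁ ip) (proj₂ ip)) (allPosL cs)

    allPosL : (cs : List (Tree A)) → List (Σ (Fin (length cs)) λ i → Pos (lookup cs i))
    allPosL []       = []
    allPosL (c ∷ cs) = map (λ p → fzero , p) (allPos c)
                       ++ map (λ ip → fsuc (proj₁ ip) , proj₂ ip) (allPosL cs)

  countTrue : List (Bool × Tree A) → ℕ
  countTrue []                 = 0
  countTrue ((true  , _) ∷ xs) = suc (countTrue xs)
  countTrue ((false , _) ∷ xs) = countTrue xs

  kept : List (Bool × Tree A) → List (Tree A)
  kept xs = map proj₂ (filterᵇ (λ bp → not (proj₁ bp)) xs)

  -- LocalPrune(T, k) as a relation (ties among equally large subtrees are
  -- broken arbitrarily, so every admissible outcome is allowed).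
  -- In the 'many' case, sel lists the pruned child subtrees in order,
  -- tagged true = discarded, false = kept; exactly k are discarded and each
  -- discarded one has at least as many nodes as each kept one.
  data LocalPrune (k : ℕ) : Tree A → Tree A → Set where
    few  : ∀ {a cs} → length cs ≤ k → LocalPrune k (node a cs) (node a [])
    many : ∀ {a cs} → k < length cs →
           (sel : List (Bool × Tree A)) →
           Pointwise (LocalPrune k) cs (map proj₂ sel) →
           countTrue sel ≡ k →
           (∀ {p q} → (true , p) ∈ sel → (false , q) ∈ sel → size q ≤ size p) →
           LocalPrune k (node a cs) (node a (kept sel))

module _ (G : Graph) where

  V : Set
  V = Fin (n G)

  initTree : ℕ → V → Tree V
  initTree B v = if deg G v <ᵇ B
                 then node v (map (λ w → node w []) (nbrs G v))
                 else node v []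

  initActive : ℕ → V → Bool
  initActive B v = deg G v <ᵇ B

  -- "at most √B nodes"  ⇔  size² ≤ B
  smallTree : ℕ → Tree V → Bool
  smallTree B t = size t * size t ≤ᵇ B

  module Attach (act : V → Bool) (P : V → Tree V) where
    mutual
      attach : ℕ → Tree V → Tree V
      attach zero    (node a [])       = if act a then P a else node a []
      attach zero    (node a (c ∷ cs)) = node a (c ∷ cs)
      attach (suc d) (node a cs)       = node a (attachL d cs)

      attachL : ℕ → List (Tree V) → List (Tree V)
      attachL d []       = []
      attachL d (c ∷ cs) = attach d c ∷ attachL d cs

  -- Run B k i T act : some execution of ExponentiateAndLocalPrune(G,B,k,·)
  -- reaches, after i iterations, trees T v = T^(i)_v and activity flags act.
  data Run (B k : ℕ) : ℕ → (V → Tree V) → (V → Bool) → Set where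
    start : Run B k 0 (initTree B) (initActive B)
    step  : ∀ {i T act} → Run B k i T act →
            (P : V → Tree V) → (∀ v → LocalPrune k (T v) (P v)) →
            Run B k (suc i)
              (λ v → if act v ∧ smallTree B (P v)
                     then Attach.attach (λ u → act u ∧ smallTree B (P u)) P (2 ^ i) (P v)
                     else P v)
              (λ v → act v ∧ smallTree B (P v))

  module Layers (t : Tree V) (a : ℕ) where

    missing : Pos t → ℕ
    missing x = length (filterᵇ
      (λ w → not (any (λ c → ⌊ root c Fin.≟ w ⌋) (kids (sub x))))
      (nbrs G (label x)))

    mutual
      -- ge m x  ⇔  x ∈ V_{≥ m+1}
      ge : ℕ → Pos t → Bool
      ge zero    x = true
      ge (suc m) x = ge m x ∧ not (inV m x)

      -- inV m x  ⇔  x ∈ V_{m+1}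
      inV : ℕ → Pos t → Bool
      inV m x = ge m x ∧ (cntKids m x + missing x ≤ᵇ a)

      cntKids : ℕ → Pos t → ℕ
      cntKids m x = length (filterᵇ (λ i → ge m (child x i))
                                   (allFin (length (kids (sub x)))))

    -- ℓ_T(x) : search j = m+1 = 1,…,L for x ∈ V_j, else ∞
    search : ℕ → ℕ → Pos t → ℕ∞
    search zero    m x = ∞
    search (suc r) m x = if inV m x then fin (suc m) else search r (suc m) x

    layer : ℕ → Pos t → ℕ∞
    layer L x = search L 0 x

  ell : (T : V → Tree V) (a L : ℕ) → V → ℕ∞
  ell T a L u =
    foldr _⊓∞_ ∞
      (concatMap (λ v → map (Layers.layer (T v) a L)
                          (filterᵇ (λ x → ⌊ label x Fin.≟ u ⌋) (allPos (T v))))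
                 (allFin (n G)))

{-# OPTIONS --safe #-}
-- Pick a node x of some tree with ℓ_T(x) = ℓ(v) = j, so x ∈ V_j.  A neighbour u of v
-- with ℓ(u) ≥ j is either missing below x, or the label of a child c of x; in the latter
-- case c ∈ V_{≥ j}, for otherwise c ∈ V_i with i < j and hence ℓ(u) ≤ i < j.  Distinct
-- such u come from distinct children, so there are at most |Missing(x)| + |children(x) ∩ V_{≥ j}|
-- of them, which is at most (s+1)k by the defining condition of V_j.
module Submission where

open import Defs
open import Data.Nat using (ℕ; suc; _*_; _≤_)
open import Data.Bool using (Bool)
open import Data.List using (length; filterᵇ)
open import Relation.Binary.PropositionalEquality using (_≢_)

open import Data.Nat using (zero; _+_; _<_; z≤n; s≤s)
open import Data.Nat.Properties
open import Data.Bool using (true; false; _∧_; not; T)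
open import Data.Bool.Properties using (T-∧; ∧-identityʳ)
import Data.Bool.ListAction as Bool
open import Data.Empty using (⊥-elim)
open import Data.Sum using (inj₁; inj₂)
open import Data.Product using (_×_; _,_; proj₂; ∃-syntax)
open import Data.Fin using (Fin) renaming (zero to fzero; suc to fsuc)
import Data.Fin as Fin
open import Data.List using (List; []; _∷_; map; foldr; _++_; concatMap; lookup; allFin)
open import Data.List.Properties using (length-++-sucʳ; length-map)
open import Data.List.Membership.Propositional using (_∈_; lose)
open import Data.List.Membership.Propositional.Properties
open import Data.List.Relation.Binary.Subset.Propositional using (_⊆_)
open import Data.List.Relation.Unary.Any using (here; there; satisfied)
import Data.List.Relation.Unary.Any as Any
open import Data.List.Relation.Unary.Any.Properties using (any⁻; lookup-index)
import Data.List.Relation.Unary.All as All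
open import Data.List.Relation.Unary.AllPairs using (_∷_)
open import Data.List.Relation.Unary.Unique.Propositional using (Unique)
import Data.List.Relation.Unary.Unique.Propositional.Properties as Unique
open import Function using (_∘_; Equivalence)
open import Relation.Binary.PropositionalEquality using (_≡_; refl; trans; subst; cong)
import Relation.Binary.PropositionalEquality as ≡
open import Relation.Nullary using (¬_)
open import Relation.Nullary.Decidable using (⌊_⌋; toWitness; fromWitness; T?; decidable-stable)

module _ {A : Set} where

  length-filterᵇ-split : (P Q : A → Bool) (xs : List A) →
    length (filterᵇ P xs) ≤ length (filterᵇ (not ∘ Q) xs) + length (filterᵇ (λ u → P u ∧ Q u) xs)
  length-filterᵇ-split P Q [] = z≤n
  length-filterᵇ-split P Q (x ∷ xs) with P x | Q x | length-filterᵇ-split P Q xs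
  ... | true  | true  | ih = subst (suc (length (filterᵇ P xs)) ≤_) (≡.sym (+-suc _ _)) (s≤s ih)
  ... | true  | false | ih = s≤s ih
  ... | false | true  | ih = ih
  ... | false | false | ih = ≤-trans ih (n≤1+n _)

  Unique-⊆⇒length≤ : {zs ys : List A} → Unique zs → zs ⊆ ys → length zs ≤ length ys
  Unique-⊆⇒length≤ {[]}     _                  _       = z≤n
  Unique-⊆⇒length≤ {z ∷ zs} (z∉zs ∷ zs-unique) z∷zs⊆ys with ∈-∃++ (z∷zs⊆ys (here refl))
  ... | ys₁ , ys₂ , refl =
    subst (suc (length zs) ≤_) (≡.sym (length-++-sucʳ ys₁ z ys₂))
          (s≤s (Unique-⊆⇒length≤ zs-unique zs⊆ys₁++ys₂))
    where
    zs⊆ys₁++ys₂ : zs ⊆ ys₁ ++ ys₂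
    zs⊆ys₁++ys₂ w∈zs with ∈-++⁻ ys₁ (z∷zs⊆ys (there w∈zs))
    ... | inj₁ w∈ys₁          = ∈-++⁺ˡ w∈ys₁
    ... | inj₂ (here refl)    = ⊥-elim (All.lookup z∉zs w∈zs refl)
    ... | inj₂ (there w∈ys₂)  = ∈-++⁺ʳ ys₁ w∈ys₂

nbrs-Unique : (G : Graph) (v : V G) → Unique (nbrs G v)
nbrs-Unique G v = Unique.filter⁺ (T? ∘ Adj G v) (Unique.allFin⁺ (n G))

infix 4 _≤∞_

data _≤∞_ : ℕ∞ → ℕ∞ → Set where
  fin≤fin : ∀ {m n} → m ≤ n → fin m ≤∞ fin n
  ≤∞-top  : ∀ {x} → x ≤∞ ∞

≤∞ᵇ⇒≤∞ : ∀ x y → T (x ≤∞ᵇ y) → x ≤∞ y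
≤∞ᵇ⇒≤∞ (fin m) (fin n) m≤n = fin≤fin (≤ᵇ⇒≤ m n m≤n)
≤∞ᵇ⇒≤∞ _       ∞       _   = ≤∞-top

≰∞ᵇ⇒≥∞ : ∀ x y → ¬ T (x ≤∞ᵇ y) → y ≤∞ x
≰∞ᵇ⇒≥∞ (fin m) (fin n) m≰n = fin≤fin (<⇒≤ (≰⇒> (m≰n ∘ ≤⇒≤ᵇ)))
≰∞ᵇ⇒≥∞ (fin m) ∞       m≰∞ = ⊥-elim (m≰∞ _)
≰∞ᵇ⇒≥∞ ∞       y       _   = ≤∞-top

≤∞-refl : ∀ x → x ≤∞ x
≤∞-refl (fin m) = fin≤fin ≤-refl
≤∞-refl ∞       = ≤∞-top

≤∞-trans : ∀ {x y z} → x ≤∞ y → y ≤∞ z → x ≤∞ z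
≤∞-trans (fin≤fin l≤m) (fin≤fin m≤n) = fin≤fin (≤-trans l≤m m≤n)
≤∞-trans _             ≤∞-top        = ≤∞-top

fin-≤∞⁻ : ∀ {m n} → fin m ≤∞ fin n → m ≤ n
fin-≤∞⁻ (fin≤fin m≤n) = m≤n

⊓∞-lowerˡ : ∀ x y → x ⊓∞ y ≤∞ x
⊓∞-lowerˡ x y with x ≤∞ᵇ y in x≤y
... | true  = ≤∞-refl x
... | false = ≰∞ᵇ⇒≥∞ x y (subst T x≤y)

⊓∞-lowerʳ : ∀ x y → x ⊓∞ y ≤∞ y
⊓∞-lowerʳ x y with x ≤∞ᵇ y in x≤y
... | true  = ≤∞ᵇ⇒≤∞ x y (subst T (≡.sym x≤y) _)
... | false = ≤∞-refl y

foldr-⊓∞-≤ : ∀ {y} xs → y ∈ xs → foldr _⊓∞_ ∞ xs ≤∞ y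
foldr-⊓∞-≤ (x ∷ xs) (here refl) = ⊓∞-lowerˡ x _
foldr-⊓∞-≤ (x ∷ xs) (there y∈xs) = ≤∞-trans (⊓∞-lowerʳ x _) (foldr-⊓∞-≤ xs y∈xs)

foldr-⊓∞-attained : ∀ xs → foldr _⊓∞_ ∞ xs ≢ ∞ → foldr _⊓∞_ ∞ xs ∈ xs
foldr-⊓∞-attained []       ∞≢∞ = ⊥-elim (∞≢∞ refl)
foldr-⊓∞-attained (x ∷ xs) min≢∞ with x ≤∞ᵇ foldr _⊓∞_ ∞ xs
... | true  = here refl
... | false = there (foldr-⊓∞-attained xs min≢∞)

module _ {A : Set} where

  label-child : {t : Tree A} (x : Pos t) (i : Fin (length (kids (sub x)))) →
                label (child x i) ≡ root (lookup (kids (sub x)) i)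
  label-child {node _ _} here        i = refl
  label-child            (there j x) i = label-child x i

  mutual
    ∈-allPos : (t : Tree A) (x : Pos t) → x ∈ allPos t
    ∈-allPos (node a cs) here        = here refl
    ∈-allPos (node a cs) (there i x) = there (∈-map⁺ _ (∈-allPosL cs i x))

    ∈-allPosL : (cs : List (Tree A)) (i : Fin (length cs)) (x : Pos (lookup cs i)) →
                (i , x) ∈ allPosL cs
    ∈-allPosL (c ∷ cs) fzero    x = ∈-++⁺ˡ (∈-map⁺ _ (∈-allPos c x))
    ∈-allPosL (c ∷ cs) (fsuc i) x = ∈-++⁺ʳ _ (∈-map⁺ _ (∈-allPosL cs i x))

child-labelled : ∀ {N} {t : Tree (Fin N)} (x : Pos t) {u} →
                 T (Bool.any (λ c → ⌊ root c Fin.≟ u ⌋) (kids (sub x))) →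
                 ∃[ i ] label (child x i) ≡ u
child-labelled x u-child = Any.index c∈ , trans (label-child x _) (toWitness (lookup-index c∈))
  where c∈ = any⁻ _ (kids (sub x)) u-child

module LayerProperties (G : Graph) (t : Tree (V G)) (a : ℕ) where
  open Layers G t a

  inV⇒cntKids+missing≤ : ∀ {m x} → T (inV m x) → cntKids m x + missing x ≤ a
  inV⇒cntKids+missing≤ x∈V = ≤ᵇ⇒≤ _ _ (proj₂ (Equivalence.to T-∧ x∈V))

  ¬ge⇒inV : ∀ m x → ¬ T (ge m x) → ∃[ i ] i < m × T (inV i x)
  ¬ge⇒inV zero    x ¬ge = ⊥-elim (¬ge _)
  ¬ge⇒inV (suc m) x ¬ge with inV m x in x∈V
  ... | true  = m , ≤-refl , subst T (≡.sym x∈V) _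
  ... | false with ¬ge⇒inV m x (¬ge ∘ subst T (≡.sym (∧-identityʳ (ge m x))))
  ...   | i , i<m , x∈Vᵢ = i , m<n⇒m<1+n i<m , x∈Vᵢ

  search≢∞⇒inV : ∀ r m x → search r m x ≢ ∞ →
                 ∃[ i ] i < m + r × T (inV i x) × search r m x ≡ fin (suc i)
  search≢∞⇒inV zero    m x ∞≢∞ = ⊥-elim (∞≢∞ refl)
  search≢∞⇒inV (suc r) m x s≢∞ with inV m x in x∈V
  ... | true  = m , m<m+n m (s≤s z≤n) , subst T (≡.sym x∈V) _ , refl
  ... | false with search≢∞⇒inV r (suc m) x s≢∞
  ...   | i , i<m+r , x∈Vᵢ , s≡i = i , subst (i <_) (≡.sym (+-suc m r)) i<m+r , x∈Vᵢ , s≡i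

  inV⇒search≤ : ∀ r m x {i} → T (inV i x) → m ≤ i → i < m + r → search r m x ≤∞ fin (suc i)
  inV⇒search≤ zero    m x {i} _    m≤i i<m+0 = ⊥-elim (<⇒≱ (subst (i <_) (+-identityʳ m) i<m+0) m≤i)
  inV⇒search≤ (suc r) m x {i} x∈Vᵢ m≤i i<m+r with inV m x in x∈V
  ... | true  = fin≤fin (s≤s m≤i)
  ... | false = inV⇒search≤ r (suc m) x x∈Vᵢ (≤∧≢⇒< m≤i m≢i) (subst (i <_) (+-suc m r) i<m+r)
    where
    m≢i : m ≢ i
    m≢i refl = subst T x∈V x∈Vᵢ

  layer≢∞⇒inV : ∀ L x → layer L x ≢ ∞ → ∃[ m ] m < L × T (inV m x) × layer L x ≡ fin (suc m)
  layer≢∞⇒inV L = search≢∞⇒inV L 0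

  inV⇒layer≤ : ∀ L x {m} → m < L → T (inV m x) → layer L x ≤∞ fin (suc m)
  inV⇒layer≤ L x m<L x∈V = inV⇒search≤ L 0 x x∈V z≤n m<L

module OutputProperties (G : Graph) (trees : V G → Tree (V G)) (a L : ℕ) where

  ℓ : V G → ℕ∞
  ℓ = ell G trees a L

  layerIn : (w : V G) → Pos (trees w) → ℕ∞
  layerIn w = Layers.layer G (trees w) a L

  copiesOf : V G → V G → List ℕ∞
  copiesOf u w = map (layerIn w) (filterᵇ (λ x → ⌊ label x Fin.≟ u ⌋) (allPos (trees w)))

  candidates : V G → List ℕ∞
  candidates u = concatMap (copiesOf u) (allFin (n G))

  ∈-candidates : ∀ w (x : Pos (trees w)) → layerIn w x ∈ candidates (label x)
  ∈-candidates w x = ∈-concatMap⁺ (copiesOf (label x)) (lose (∈-allFin w)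
    (∈-map⁺ (layerIn w) (∈-filter⁺ (T? ∘ λ y → ⌊ label y Fin.≟ label x ⌋)
                                    (∈-allPos (trees w) x) (fromWitness refl))))

  ∈-candidates⁻ : ∀ {u y} → y ∈ candidates u →
                  ∃[ w ] ∃[ x ] label {t = trees w} x ≡ u × y ≡ layerIn w x
  ∈-candidates⁻ {u} y∈ with satisfied (∈-concatMap⁻ (copiesOf u) {xs = allFin (n G)} y∈)
  ... | w , y∈copies with ∈-map⁻ (layerIn w) y∈copies
  ...   | x , x∈ , y≡ =
    w , x , toWitness (proj₂ (∈-filter⁻ (T? ∘ λ y → ⌊ label y Fin.≟ u ⌋) {xs = allPos (trees w)} x∈)) , y≡

  ℓ≤layer : ∀ w (x : Pos (trees w)) → ℓ (label x) ≤∞ layerIn w x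
  ℓ≤layer w x = foldr-⊓∞-≤ (candidates (label x)) (∈-candidates w x)

  ℓ-attained : ∀ {u} → ℓ u ≢ ∞ → ∃[ w ] ∃[ x ] label {t = trees w} x ≡ u × ℓ u ≡ layerIn w x
  ℓ-attained {u} ℓu≢∞ = ∈-candidates⁻ (foldr-⊓∞-attained (candidates u) ℓu≢∞)

  upperNeighbours : V G → List (V G)
  upperNeighbours v = filterᵇ (λ u → ℓ v ≤∞ᵇ ℓ u) (nbrs G v)

  module _ {w : V G} (x : Pos (trees w)) {m : ℕ} (m<L : m < L)
           (x∈V : T (Layers.inV G (trees w) a m x)) (ℓx≡ : ℓ (label x) ≡ fin (suc m)) where
    open Layers G (trees w) a
    open LayerProperties G (trees w) a

    isChildLabel : V G → Bool
    isChildLabel u = Bool.any (λ c → ⌊ root c Fin.≟ u ⌋) (kids (sub x))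

    atLeastℓx : V G → Bool
    atLeastℓx u = ℓ (label x) ≤∞ᵇ ℓ u

    survivingChildren : List (Fin (length (kids (sub x))))
    survivingChildren = filterᵇ (ge m ∘ child x) (allFin (length (kids (sub x))))

    survivingChildLabels : List (V G)
    survivingChildLabels = map (label ∘ child x) survivingChildren

    upperChild-survives : ∀ i → T (atLeastℓx (label (child x i))) → T (ge m (child x i))
    upperChild-survives i ℓx≤ℓc = decidable-stable (T? _) λ c∉V≥ →
      let j , j<m , c∈Vⱼ = ¬ge⇒inV m (child x i) c∉V≥
          ℓc≤j = ≤∞-trans (ℓ≤layer w (child x i)) (inV⇒layer≤ L (child x i) (<-trans j<m m<L) c∈Vⱼ)
      in <⇒≱ j<m (≤-pred (fin-≤∞⁻ (subst (_≤∞ fin (suc j)) ℓx≡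
                                (≤∞-trans (≤∞ᵇ⇒≤∞ (ℓ (label x)) (ℓ (label (child x i))) ℓx≤ℓc) ℓc≤j))))

    upperChild⇒surviving : ∀ {u} → T (atLeastℓx u) → T (isChildLabel u) → u ∈ survivingChildLabels
    upperChild⇒surviving {u} ℓx≤ℓu u-child =
      let i , labelᵢ≡u = child-labelled x u-child
      in subst (_∈ survivingChildLabels) labelᵢ≡u
           (∈-map⁺ (label ∘ child x)
             (∈-filter⁺ (T? ∘ ge m ∘ child x) (∈-allFin i)
               (upperChild-survives i (subst (T ∘ atLeastℓx) (≡.sym labelᵢ≡u) ℓx≤ℓu))))

    upperNeighbours-bounded : length (upperNeighbours (label x)) ≤ a
    upperNeighbours-bounded = begin
      length (upperNeighbours (label x))
        ≤⟨ length-filterᵇ-split atLeastℓx isChildLabel (nbrs G (label x)) ⟩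
      missing x + length upperChildren
        ≤⟨ +-monoʳ-≤ (missing x) (Unique-⊆⇒length≤ upperChildren-Unique upperChildren⊆) ⟩
      missing x + length survivingChildLabels
        ≡⟨ cong (missing x +_) (length-map (label ∘ child x) survivingChildren) ⟩
      missing x + cntKids m x
        ≡⟨ +-comm (missing x) (cntKids m x) ⟩
      cntKids m x + missing x
        ≤⟨ inV⇒cntKids+missing≤ {m} {x} x∈V ⟩
      a ∎
      where
      open ≤-Reasoning
      upperChild? : V G → Bool
      upperChild? u = atLeastℓx u ∧ isChildLabel u
      upperChildren : List (V G)
      upperChildren = filterᵇ upperChild? (nbrs G (label x))
      upperChildren-Unique : Unique upperChildren
      upperChildren-Unique = Unique.filter⁺ (T? ∘ upperChild?) (nbrs-Unique G (label x))
      upperChildren⊆ : upperChildren ⊆ survivingChildLabels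
      upperChildren⊆ u∈ =
        let ℓx≤ℓu , u-child = Equivalence.to T-∧ (proj₂ (∈-filter⁻ (T? ∘ upperChild?) {xs = nbrs G (label x)} u∈))
        in upperChild⇒surviving ℓx≤ℓu u-child

mainTheorem12 : (G : Graph) (B k L s : ℕ)
    (T : V G → Tree (V G)) (act : V G → Bool) →
    Run G B k s T act →
    ∀ v → ell G T (suc s * k) L v ≢ ∞ →
    length (filterᵇ (λ u → ell G T (suc s * k) L v ≤∞ᵇ ell G T (suc s * k) L u) (nbrs G v))
      ≤ suc s * k
mainTheorem12 G B k L s T act _ v ℓv≢∞ =
  let w , x , x↦v , ℓv≡layer = ℓ-attained ℓv≢∞
      m , m<L , x∈Vₘ , layer≡ = layer≢∞⇒inV G (T w) a L x (subst (_≢ ∞) ℓv≡layer ℓv≢∞)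
      ℓx≡ = trans (cong ℓ x↦v) (trans ℓv≡layer layer≡)
  in subst (λ v → length (upperNeighbours v) ≤ a) x↦v (upperNeighbours-bounded x m<L x∈Vₘ ℓx≡)
  where
  a = suc s * k
  open OutputProperties G T a L
  open LayerProperties using (layer≢∞⇒inV)
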